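{- Let $s,t$ be coprime integers greater than $1$. Suppose $\alpha,\beta$ are partitions with $\alpha_1,\beta_1\le t$ and $\alpha'_1,\beta'_1\le s$, and suppose there are exactly two $s\times t$ matrices with entries in $\{0,1\}$ having row sums $\alpha_1,\dots,\alpha_s$ and column sums $\beta'_1,\dots,\beta'_t$. Then there is some $a\in\{1,\dots,s-1\}$ such that $\alpha_a=\alpha_{a+1}$ and $$\beta=(\alpha_1,\dots,\alpha_{a-1},\alpha_a+1,\alpha_a-1,\alpha_{a+2},\alpha_{a+3},\dots).$$
   Context: A partition $\alpha=(\alpha_1\ge\alpha_2\ge\dots)$ of non-negative integers with finitely many nonzero terms; its conjugate $\alpha'$ is defined by $\alpha'_r=|\{c:\alpha_c\ge r\}|$. -}

module Defs where

open import Data.Nat using (ℕ; zero; suc; _+_; _≤_; _<_; _≤ᵇ_)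
open import Data.Bool using (Bool; true; false; if_then_else_)
open import Data.List using (List; []; _∷_; length; filter)
open import Data.List.Relation.Unary.All using (All)
open import Data.List.Relation.Unary.Linked using (Linked)
open import Data.Nat.Properties using (_≤?_)
open import Data.Fin using (Fin; toℕ)
open import Data.Vec using (Vec; lookup)
open import Data.Product using (_×_)
open import Relation.Binary.PropositionalEquality using (_≡_)

IsPartition : List ℕ → Set
IsPartition α = Linked (λ x y → y ≤ x) α × All (λ x → 0 < x) α

-- The i-th part α_i (1-indexed); α_0 is unused, parts beyond the list are 0.
part : List ℕ → ℕ → ℕ
part []       _             = 0
part (x ∷ xs) zero          = 0
part (x ∷ xs) (suc zero)    = x
part (x ∷ xs) (suc (suc i)) = part xs (suc i)

-- Conjugate: α'_r = |{c : α_c ≥ r}| (meaningful for r ≥ 1).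
conj : List ℕ → ℕ → ℕ
conj α r = length (filter (λ x → r ≤? x) α)

Matrix01 : ℕ → ℕ → Set
Matrix01 s t = Vec (Vec Bool t) s

b2n : Bool → ℕ
b2n true  = 1
b2n false = 0

sumFin : (n : ℕ) → (Fin n → ℕ) → ℕ
sumFin zero    f = 0
sumFin (suc n) f = f Fin.zero + sumFin n (λ i → f (Fin.suc i))

rowSum : ∀ {s t} → Matrix01 s t → Fin s → ℕ
rowSum {s} {t} M i = sumFin t (λ j → b2n (lookup (lookup M i) j))

colSum : ∀ {s t} → Matrix01 s t → Fin t → ℕ
colSum {s} {t} M j = sumFin s (λ i → b2n (lookup (lookup M i) j))

HasMargins : ∀ {s t} → List ℕ → List ℕ → Matrix01 s t → Set
HasMargins {s} {t} α β M =
  (∀ (i : Fin s) → rowSum M i ≡ part α (suc (toℕ i))) ×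
  (∀ (j : Fin t) → colSum M j ≡ conj β (suc (toℕ j)))

-- A 0/1 matrix with no inversion (a 0 above a 1 in some column) has top-justified
-- columns, so it is determined by its column sums. Hence one realisation, M, has an
-- inversion (p, q, u). Since α is decreasing there is also a column v with a 1 in row p
-- and a 0 in row q; interchanging the 2×2 submatrix on rows p, q and columns u, v gives
-- a realisation different from M, that is, the other one, N. Every inversion of M
-- yields such an interchange producing N, so (p, q, u) is the only inversion of M:
-- q = p + 1, the columns j ≠ u of M are top-justified, and rows p and q agree off
-- {u, v}, whence α_p = α_q. As N has the inversion (p, q, v), its column u is
-- top-justified as well. A top-justified column with sum β'_j has a 1 in row x exactly
-- when x ≤ β'_j, and there are β_x such columns j; so counting row x of M column by
-- column, with column u taken from N, gives α_x + N_xu = β_x + M_xu.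
module Submission where

open import Defs
open import Data.Nat using (ℕ; zero; suc; _+_; _≤_; _<_; _≥_; z≤n; s≤s; z<s; s<s; s<s⁻¹)
open import Data.Nat.Properties
  using ( _≤?_; _<?_; ≤-refl; ≤-reflexive; ≤-trans; ≤-antisym; ≤-<-trans; <-trans; <⇒≤; <⇒≱
        ; ≰⇒>; ≮⇒≥; <-irrefl; <-asym; n≤0⇒n≡0; +-comm; +-assoc; +-identityʳ; +-cancelʳ-≡
        ; +-mono-≤; +-mono-<-≤; +-mono-≤-< )
open import Data.Nat.Coprimality using (Coprime)
open import Data.Bool using (Bool; true; false; not; if_then_else_)
open import Data.Bool.Properties using (not-¬; not-involutive) renaming (_≟_ to _≟ᵇ_)
open import Data.List using (List; []; _∷_; length)
open import Data.List.Properties using (filter-accept; filter-reject)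
open import Data.List.Relation.Unary.Linked using (Linked; [-]; _∷_; tail)
open import Data.Fin using (Fin; toℕ; fromℕ<) renaming (_≟_ to _≟ᶠ_)
open import Data.Fin.Properties using (any?; toℕ<n; toℕ-fromℕ<) renaming (suc-injective to Fin-suc-injective)
open import Data.Vec using (Vec; lookup; tabulate)
open import Data.Vec.Properties using (lookup∘tabulate; tabulate∘lookup; tabulate-cong)
open import Data.Product using (Σ; _×_; _,_; proj₁; proj₂; ∃-syntax)
open import Data.Sum using (_⊎_; inj₁; inj₂; [_,_]; swap; fromInj₁)
open import Data.Empty using (⊥; ⊥-elim)
open import Function.Base using (_∘_)
open import Function.Bundles using (_⇔_; mk⇔)
open import Relation.Nullary using (¬_; Dec; yes; no; does; contradiction)
open import Relation.Nullary.Decidable using (_×-dec_; _⊎-dec_; dec-true; dec-false; does-⇔)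
open import Relation.Binary.PropositionalEquality
  using (_≡_; _≢_; refl; sym; trans; cong; cong₂; subst; subst₂; module ≡-Reasoning)

-- Parts and conjugates of a decreasing list

conj-accept : ∀ {r x} xs → r ≤ x → conj (x ∷ xs) r ≡ suc (conj xs r)
conj-accept {r} xs r≤x = cong length (filter-accept (r ≤?_) r≤x)

conj-reject : ∀ {r x} xs → ¬ r ≤ x → conj (x ∷ xs) r ≡ conj xs r
conj-reject {r} xs r≰x = cong length (filter-reject (r ≤?_) r≰x)

conj-above-head : ∀ {r x xs} → Linked _≥_ (x ∷ xs) → x < r → conj (x ∷ xs) r ≡ 0
conj-above-head {xs = []}     [-]        x<r = conj-reject [] (<⇒≱ x<r)
conj-above-head {xs = y ∷ ys} (x≥y ∷ y↓) x<r =
  trans (conj-reject (y ∷ ys) (<⇒≱ x<r)) (conj-above-head y↓ (≤-<-trans x≥y x<r))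

part-≤-head : ∀ {x xs} → Linked _≥_ (x ∷ xs) → ∀ i → part xs i ≤ x
part-≤-head {xs = []}     _          _             = z≤n
part-≤-head {xs = y ∷ ys} _          zero          = z≤n
part-≤-head {xs = y ∷ ys} (x≥y ∷ _)  (suc zero)    = x≥y
part-≤-head {xs = y ∷ ys} (x≥y ∷ y↓) (suc (suc i)) = ≤-trans (part-≤-head y↓ (suc i)) x≥y

part-antitone : ∀ {xs} → Linked _≥_ xs → ∀ {i i'} → i ≤ i' → part xs (suc i') ≤ part xs (suc i)
part-antitone {[]}     _  _                           = z≤n
part-antitone {x ∷ xs} x↓ {zero}  {zero}   _          = ≤-refl
part-antitone {x ∷ xs} x↓ {zero}  {suc i'} _          = part-≤-head x↓ (suc i')
part-antitone {x ∷ xs} x↓ {suc i} {suc i'} (s≤s i≤i') = part-antitone (tail x↓) i≤i'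

<part⇒<conj : ∀ {β} → Linked _≥_ β → ∀ i {r} → r < part β (suc i) → i < conj β (suc r)
<part⇒<conj {x ∷ xs} x↓ zero    r<x = subst (0 <_) (sym (conj-accept xs r<x)) z<s
<part⇒<conj {x ∷ xs} x↓ (suc i) r<β =
  subst (suc i <_) (sym (conj-accept xs (≤-trans r<β (part-≤-head x↓ (suc i)))))
        (s<s (<part⇒<conj (tail x↓) i r<β))

<conj⇒<part : ∀ {β} → Linked _≥_ β → ∀ i {r} → i < conj β (suc r) → r < part β (suc i)
<conj⇒<part {x ∷ xs} x↓ i {r} i<β' with suc r ≤? x
... | no  r≮x = contradiction (subst (i <_) (conj-above-head x↓ (≰⇒> r≮x)) i<β') λ ()
<conj⇒<part {x ∷ xs} x↓ zero    i<β' | yes r<x = r<x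
<conj⇒<part {x ∷ xs} x↓ (suc i) i<β' | yes r<x =
  <conj⇒<part (tail x↓) i (s<s⁻¹ (subst (suc i <_) (conj-accept xs r<x) i<β'))

conj-duality : ∀ {β} → Linked _≥_ β → ∀ i r → i < conj β (suc r) ⇔ r < part β (suc i)
conj-duality β↓ i r = mk⇔ (<conj⇒<part β↓ i) (<part⇒<conj β↓ i)

part-vanishes : ∀ {β s} → Linked _≥_ β → conj β 1 ≤ s → ∀ {i} → s ≤ i → part β (suc i) ≡ 0
part-vanishes β↓ β'₁≤s {i} s≤i =
  n≤0⇒n≡0 (≮⇒≥ λ 0<βᵢ → <⇒≱ (<part⇒<conj β↓ i 0<βᵢ) (≤-trans β'₁≤s s≤i))

sumFin-cong : ∀ n {f g : Fin n → ℕ} → (∀ j → f j ≡ g j) → sumFin n f ≡ sumFin n g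
sumFin-cong zero    f≗g = refl
sumFin-cong (suc n) f≗g = cong₂ _+_ (f≗g Fin.zero) (sumFin-cong n (f≗g ∘ Fin.suc))

sumFin-zero : ∀ n {f : Fin n → ℕ} → (∀ j → f j ≡ 0) → sumFin n f ≡ 0
sumFin-zero zero    f≗0 = refl
sumFin-zero (suc n) f≗0 = cong₂ _+_ (f≗0 Fin.zero) (sumFin-zero n (f≗0 ∘ Fin.suc))

sumFin-mono-≤ : ∀ n {f g : Fin n → ℕ} → (∀ j → f j ≤ g j) → sumFin n f ≤ sumFin n g
sumFin-mono-≤ zero    f≤g = z≤n
sumFin-mono-≤ (suc n) f≤g = +-mono-≤ (f≤g Fin.zero) (sumFin-mono-≤ n (f≤g ∘ Fin.suc))

sumFin-mono-< : ∀ n {f g : Fin n → ℕ} → (∀ j → f j ≤ g j) → ∀ j → f j < g j → sumFin n f < sumFin n g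
sumFin-mono-< (suc n) f≤g Fin.zero    f<g = +-mono-<-≤ f<g (sumFin-mono-≤ n (f≤g ∘ Fin.suc))
sumFin-mono-< (suc n) f≤g (Fin.suc j) f<g = +-mono-≤-< (f≤g Fin.zero) (sumFin-mono-< n (f≤g ∘ Fin.suc) j f<g)

sumFin-exchange : ∀ n {f g : Fin n → ℕ} a → (∀ j → j ≢ a → f j ≡ g j) →
  sumFin n f + g a ≡ sumFin n g + f a
sumFin-exchange (suc n) {f} {g} Fin.zero f≗g = begin
  f₀ + sumFin n (f ∘ Fin.suc) + g₀ ≡⟨ cong (λ S → f₀ + S + g₀) (sumFin-cong n λ j → f≗g (Fin.suc j) λ ()) ⟩
  f₀ + S + g₀                      ≡⟨ +-comm (f₀ + S) g₀ ⟩
  g₀ + (f₀ + S)                    ≡⟨ cong (g₀ +_) (+-comm f₀ S) ⟩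
  g₀ + (S + f₀)                    ≡⟨ +-assoc g₀ S f₀ ⟨
  g₀ + S + f₀                      ∎
  where
  open ≡-Reasoning
  f₀ g₀ S : ℕ
  f₀ = f Fin.zero
  g₀ = g Fin.zero
  S  = sumFin n (g ∘ Fin.suc)
sumFin-exchange (suc n) {f} {g} (Fin.suc a) f≗g = begin
  f₀ + sumFin n (f ∘ Fin.suc) + g (Fin.suc a)     ≡⟨ +-assoc f₀ _ _ ⟩
  f₀ + (sumFin n (f ∘ Fin.suc) + g (Fin.suc a))   ≡⟨ cong₂ _+_ (f≗g Fin.zero λ ()) tail-exchange ⟩
  g₀ + (sumFin n (g ∘ Fin.suc) + f (Fin.suc a))   ≡⟨ +-assoc g₀ _ _ ⟨
  g₀ + sumFin n (g ∘ Fin.suc) + f (Fin.suc a)     ∎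
  where
  open ≡-Reasoning
  f₀ g₀ : ℕ
  f₀ = f Fin.zero
  g₀ = g Fin.zero
  tail-exchange : sumFin n (f ∘ Fin.suc) + g (Fin.suc a) ≡ sumFin n (g ∘ Fin.suc) + f (Fin.suc a)
  tail-exchange = sumFin-exchange n a λ j j≢a → f≗g (Fin.suc j) (j≢a ∘ Fin-suc-injective)

sumFin-transpose₀ : ∀ n {f g : Fin (suc n) → ℕ} b → f Fin.zero ≡ g (Fin.suc b) → f (Fin.suc b) ≡ g Fin.zero →
  (∀ j → j ≢ Fin.zero → j ≢ Fin.suc b → f j ≡ g j) → sumFin (suc n) f ≡ sumFin (suc n) g
sumFin-transpose₀ n {f} {g} b f₀≡gb fb≡g₀ f≗g = begin
  f₀ + Sf             ≡⟨ +-comm f₀ Sf ⟩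
  Sf + f₀             ≡⟨ cong (Sf +_) f₀≡gb ⟩
  Sf + g (Fin.suc b)  ≡⟨ sumFin-exchange n b (λ j j≢b → f≗g (Fin.suc j) (λ ()) (j≢b ∘ Fin-suc-injective)) ⟩
  Sg + f (Fin.suc b)  ≡⟨ cong (Sg +_) fb≡g₀ ⟩
  Sg + g₀             ≡⟨ +-comm Sg g₀ ⟩
  g₀ + Sg             ∎
  where
  open ≡-Reasoning
  f₀ g₀ Sf Sg : ℕ
  f₀ = f Fin.zero
  g₀ = g Fin.zero
  Sf = sumFin n (f ∘ Fin.suc)
  Sg = sumFin n (g ∘ Fin.suc)

sumFin-transpose : ∀ n {f g : Fin n → ℕ} a b → f a ≡ g b → f b ≡ g a →
  (∀ j → j ≢ a → j ≢ b → f j ≡ g j) → sumFin n f ≡ sumFin n g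
sumFin-transpose (suc n) Fin.zero    Fin.zero    f₀≡g₀ _     f≗g =
  cong₂ _+_ f₀≡g₀ (sumFin-cong n λ j → f≗g (Fin.suc j) (λ ()) (λ ()))
sumFin-transpose (suc n) Fin.zero    (Fin.suc b) fa≡gb fb≡ga f≗g = sumFin-transpose₀ n b fa≡gb fb≡ga f≗g
sumFin-transpose (suc n) (Fin.suc a) Fin.zero    fa≡gb fb≡ga f≗g =
  sumFin-transpose₀ n a fb≡ga fa≡gb λ j j≢b j≢a → f≗g j j≢a j≢b
sumFin-transpose (suc n) (Fin.suc a) (Fin.suc b) fa≡gb fb≡ga f≗g =
  cong₂ _+_ (f≗g Fin.zero (λ ()) (λ ()))
    (sumFin-transpose n a b fa≡gb fb≡ga λ j j≢a j≢b →
      f≗g (Fin.suc j) (j≢a ∘ Fin-suc-injective) (j≢b ∘ Fin-suc-injective))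

count : ∀ {n} → (Fin n → Bool) → ℕ
count {n} f = sumFin n (λ j → b2n (f j))

count-initial : ∀ {m n} → m ≤ n → count {n} (λ j → does (toℕ j <? m)) ≡ m
count-initial {zero}  {n}     _         = sumFin-zero n λ _ → refl
count-initial {suc m} {suc n} (s≤s m≤n) = cong suc (count-initial m≤n)

count-conj : ∀ {β t} → Linked _≥_ β → part β 1 ≤ t → ∀ k →
  count {t} (λ j → does (k <? conj β (suc (toℕ j)))) ≡ part β (suc k)
count-conj {β} {t} β↓ β₁≤t k = trans
  (sumFin-cong t λ j → cong b2n (does-⇔ (conj-duality β↓ k (toℕ j)) (k <? _) (toℕ j <? part β (suc k))))
  (count-initial (≤-trans (part-antitone β↓ z≤n) β₁≤t))

count-opposite : ∀ {n} (f g : Fin n → Bool) {j} → count g ≤ count f → f j ≡ false → g j ≡ true →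
  ∃[ j' ] (f j' ≡ true × g j' ≡ false)
count-opposite {n} f g {j} g≤f fj gj with any? (λ j' → (f j' ≟ᵇ true) ×-dec (g j' ≟ᵇ false))
... | yes found = found
... | no  none  = contradiction g≤f (<⇒≱ (sumFin-mono-< n f≤g j f<g))
  where
  f≤g : ∀ j' → b2n (f j') ≤ b2n (g j')
  f≤g j' with f j' in fj' | g j' in gj'
  ... | false | _     = z≤n
  ... | true  | true  = ≤-refl
  ... | true  | false = ⊥-elim (none (j' , fj' , gj'))
  f<g : b2n (f j) < b2n (g j)
  f<g = subst₂ (λ a b → b2n a < b2n b) (sym fj) (sym gj) z<s

count-flip-opposite : ∀ {n} {f g : Fin n → Bool} a b → g b ≡ not (g a) →
  f a ≡ not (g a) → f b ≡ not (g b) → (∀ j → j ≢ a → j ≢ b → f j ≡ g j) → count f ≡ count g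
count-flip-opposite a b gb fa fb f≗g = sumFin-transpose _ a b
  (cong b2n (trans fa (sym gb)))
  (cong b2n (trans fb (trans (cong not gb) (not-involutive _))))
  (λ j j≢a j≢b → cong b2n (f≗g j j≢a j≢b))

TopJustified : ∀ {n} → (Fin n → Bool) → Set
TopJustified f = ∀ i i' → toℕ i < toℕ i' → f i ≡ false → f i' ≡ true → ⊥

topJustified⇒initial : ∀ {n} {f : Fin n → Bool} → TopJustified f → ∀ x → f x ≡ does (toℕ x <? count f)
topJustified⇒initial {suc n} {f} f↑ x with f Fin.zero in f₀
topJustified⇒initial {suc n} {f} f↑ Fin.zero    | true = f₀
topJustified⇒initial {suc n} {f} f↑ (Fin.suc x) | true =
  topJustified⇒initial (λ i i' i<i' → f↑ (Fin.suc i) (Fin.suc i') (s<s i<i')) x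
... | false = trans (all-false x)
  (cong (λ c → does (toℕ x <? c)) (sym (sumFin-zero n λ j → cong b2n (all-false (Fin.suc j)))))
  where
  all-false : ∀ y → f y ≡ false
  all-false Fin.zero    = f₀
  all-false (Fin.suc y) with f (Fin.suc y) in f-y
  ... | false = refl
  ... | true  = ⊥-elim (f↑ Fin.zero (Fin.suc y) z<s f₀ f-y)

-- Inversions and interchanges of 0/1 matrices

entry : ∀ {s t} → Matrix01 s t → Fin s → Fin t → Bool
entry M i j = lookup (lookup M i) j

matrix-ext : ∀ {s t} {M N : Matrix01 s t} → (∀ i j → entry M i j ≡ entry N i j) → M ≡ N
matrix-ext M≗N = vec-ext λ i → vec-ext (M≗N i)
  where
  vec-ext : ∀ {A : Set} {n} {xs ys : Vec A n} → (∀ i → lookup xs i ≡ lookup ys i) → xs ≡ ys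
  vec-ext {xs = xs} {ys} xs≗ys = trans (sym (tabulate∘lookup xs)) (trans (tabulate-cong xs≗ys) (tabulate∘lookup ys))

Inversion : ∀ {s t} → Matrix01 s t → Fin s → Fin s → Fin t → Set
Inversion M i i' j = toℕ i < toℕ i' × entry M i j ≡ false × entry M i' j ≡ true

HasInversion : ∀ {s t} → Matrix01 s t → Set
HasInversion M = ∃[ i ] ∃[ i' ] ∃[ j ] Inversion M i i' j

hasInversion? : ∀ {s t} (M : Matrix01 s t) → Dec (HasInversion M)
hasInversion? M = any? λ i → any? λ i' → any? λ j →
  (toℕ i <? toℕ i') ×-dec (entry M i j ≟ᵇ false) ×-dec (entry M i' j ≟ᵇ true)

inversionFree-unique : ∀ {s t} {M N : Matrix01 s t} → ¬ HasInversion M → ¬ HasInversion N →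
  (∀ j → colSum M j ≡ colSum N j) → M ≡ N
inversionFree-unique {M = M} {N} ¬invM ¬invN colM≗colN = matrix-ext λ i j → begin
  entry M i j                ≡⟨ topJustified⇒initial (λ i i' i<i' e e' → ¬invM (i , i' , j , i<i' , e , e')) i ⟩
  does (toℕ i <? colSum M j) ≡⟨ cong (λ c → does (toℕ i <? c)) (colM≗colN j) ⟩
  does (toℕ i <? colSum N j) ≡⟨ topJustified⇒initial (λ i i' i<i' e e' → ¬invN (i , i' , j , i<i' , e , e')) i ⟨
  entry N i j                ∎
  where open ≡-Reasoning

InRectangle : ∀ {s t} → Fin s → Fin s → Fin t → Fin t → Fin s → Fin t → Set
InRectangle p q u v i j = (i ≡ p ⊎ i ≡ q) × (j ≡ u ⊎ j ≡ v)

inRectangle? : ∀ {s t} (p q : Fin s) (u v : Fin t) i j → Dec (InRectangle p q u v i j)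
inRectangle? p q u v i j = ((i ≟ᶠ p) ⊎-dec (i ≟ᶠ q)) ×-dec ((j ≟ᶠ u) ⊎-dec (j ≟ᶠ v))

interchange : ∀ {s t} → Matrix01 s t → Fin s → Fin s → Fin t → Fin t → Matrix01 s t
interchange M p q u v = tabulate λ i → tabulate λ j →
  if does (inRectangle? p q u v i j) then not (entry M i j) else entry M i j

Interchangeable : ∀ {s t} → Matrix01 s t → Fin s → Fin s → Fin t → Fin t → Set
Interchangeable M p q u v =
  entry M p u ≡ false × entry M q u ≡ true × entry M p v ≡ true × entry M q v ≡ false

module _ {s t} (M : Matrix01 s t) (p q : Fin s) (u v : Fin t) where

  entry-interchange : ∀ i j → entry (interchange M p q u v) i j ≡
    (if does (inRectangle? p q u v i j) then not (entry M i j) else entry M i j)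
  entry-interchange i j = trans (cong (λ row → lookup row j) (lookup∘tabulate _ i)) (lookup∘tabulate _ j)

  interchange-flips : ∀ {i j} → InRectangle p q u v i j → entry (interchange M p q u v) i j ≡ not (entry M i j)
  interchange-flips {i} {j} r =
    trans (entry-interchange i j) (cong (if_then _ else _) (dec-true (inRectangle? p q u v i j) r))

  interchange-keeps : ∀ {i j} → ¬ InRectangle p q u v i j → entry (interchange M p q u v) i j ≡ entry M i j
  interchange-keeps {i} {j} ¬r =
    trans (entry-interchange i j) (cong (if_then _ else _) (dec-false (inRectangle? p q u v i j) ¬r))

  interchange-≢ : interchange M p q u v ≢ M
  interchange-≢ I≡M =
    not-¬ refl (trans (cong (λ L → entry L p u) (sym I≡M)) (interchange-flips (inj₁ refl , inj₁ refl)))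

  swapped-row : ∀ {i} → (i ≡ p ⊎ i ≡ q) → entry M i v ≡ not (entry M i u) →
    rowSum (interchange M p q u v) i ≡ rowSum M i
  swapped-row i∈ opposite = count-flip-opposite u v opposite
    (interchange-flips (i∈ , inj₁ refl)) (interchange-flips (i∈ , inj₂ refl))
    (λ j j≢u j≢v → interchange-keeps λ (_ , j∈) → [ j≢u , j≢v ] j∈)

  swapped-column : ∀ {j} → (j ≡ u ⊎ j ≡ v) → entry M q j ≡ not (entry M p j) →
    colSum (interchange M p q u v) j ≡ colSum M j
  swapped-column j∈ opposite = count-flip-opposite p q opposite
    (interchange-flips (inj₁ refl , j∈)) (interchange-flips (inj₂ refl , j∈))
    (λ i i≢p i≢q → interchange-keeps λ (i∈ , _) → [ i≢p , i≢q ] i∈)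

  interchange-margins : ∀ {α β} → Interchangeable M p q u v → HasMargins α β M →
    HasMargins α β (interchange M p q u v)
  interchange-margins (pu , qu , pv , qv) (rows , columns) =
    (λ i → trans (rowSum-preserved i) (rows i)) , (λ j → trans (colSum-preserved j) (columns j))
    where
    rowSum-preserved : ∀ i → rowSum (interchange M p q u v) i ≡ rowSum M i
    rowSum-preserved i with i ≟ᶠ p | i ≟ᶠ q
    ... | yes refl | _        = swapped-row (inj₁ refl) (trans pv (cong not (sym pu)))
    ... | no _     | yes refl = swapped-row (inj₂ refl) (trans qv (cong not (sym qu)))
    ... | no i≢p   | no i≢q   = sumFin-cong t λ j → cong b2n (interchange-keeps λ (i∈ , _) → [ i≢p , i≢q ] i∈)
    colSum-preserved : ∀ j → colSum (interchange M p q u v) j ≡ colSum M j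
    colSum-preserved j with j ≟ᶠ u | j ≟ᶠ v
    ... | yes refl | _        = swapped-column (inj₁ refl) (trans qu (cong not (sym pu)))
    ... | no _     | yes refl = swapped-column (inj₂ refl) (trans qv (cong not (sym pv)))
    ... | no j≢u   | no j≢v   = sumFin-cong s λ i → cong b2n (interchange-keeps λ (_ , j∈) → [ j≢u , j≢v ] j∈)

-- Two realisations differing by an interchange

module UniqueInterchange
  {s t} {α β : List ℕ} (α↓ : Linked _≥_ α)
  {M N : Matrix01 s t} (M≢N : M ≢ N) (M-margins : HasMargins α β M) (N-margins : HasMargins α β N)
  (only-M-N : ∀ L → HasMargins α β L → L ≡ M ⊎ L ≡ N)
  {p q : Fin s} {u : Fin t} (pqu : Inversion M p q u)
  where

  p<q : toℕ p < toℕ q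
  p<q = proj₁ pqu

  pu : entry M p u ≡ false
  pu = proj₁ (proj₂ pqu)

  qu : entry M q u ≡ true
  qu = proj₂ (proj₂ pqu)

  rowSum-antitone : ∀ {i i'} → toℕ i < toℕ i' → rowSum M i' ≤ rowSum M i
  rowSum-antitone {i} {i'} i<i' =
    subst₂ _≤_ (sym (proj₁ M-margins i')) (sym (proj₁ M-margins i)) (part-antitone α↓ (<⇒≤ i<i'))

  inversion⇒interchangeable : ∀ {i i' j} → Inversion M i i' j → ∃[ j' ] Interchangeable M i i' j j'
  inversion⇒interchangeable {i} {i'} (i<i' , ij , i'j)
    with count-opposite (entry M i) (entry M i') (rowSum-antitone i<i') ij i'j
  ... | j' , ij' , i'j' = j' , ij , i'j , ij' , i'j'

  interchange≡N : ∀ {a b c d} → Interchangeable M a b c d → interchange M a b c d ≡ N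
  interchange≡N {a} {b} {c} {d} ι with only-M-N _ (interchange-margins M a b c d {α} {β} ι M-margins)
  ... | inj₁ I≡M = contradiction I≡M (interchange-≢ M a b c d)
  ... | inj₂ I≡N = I≡N

  N-differs-inside : ∀ {a b c d} → Interchangeable M a b c d →
    ∀ {i j} → InRectangle a b c d i j → entry N i j ≢ entry M i j
  N-differs-inside {a} {b} {c} {d} ι {i} {j} r N≡M = not-¬ refl (begin
    entry M i j                       ≡⟨ N≡M ⟨
    entry N i j                       ≡⟨ cong (λ L → entry L i j) (interchange≡N ι) ⟨
    entry (interchange M a b c d) i j ≡⟨ interchange-flips M a b c d r ⟩
    not (entry M i j)                 ∎)
    where open ≡-Reasoning

  v : Fin t
  v = proj₁ (inversion⇒interchangeable pqu)

  pquv : Interchangeable M p q u v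
  pquv = proj₂ (inversion⇒interchangeable pqu)

  pv : entry M p v ≡ true
  pv = proj₁ (proj₂ (proj₂ pquv))

  qv : entry M q v ≡ false
  qv = proj₂ (proj₂ (proj₂ pquv))

  p-zero⇒≢v : ∀ {j} → entry M p j ≡ false → j ≢ v
  p-zero⇒≢v pj j≡v = contradiction (trans (sym pj) (trans (cong (entry M p) j≡v) pv)) λ ()

  N-flips : ∀ {i j} → InRectangle p q u v i j → entry N i j ≡ not (entry M i j)
  N-flips r = trans (cong (λ L → entry L _ _) (sym (interchange≡N pquv))) (interchange-flips M p q u v r)

  N-keeps : ∀ {i j} → ¬ InRectangle p q u v i j → entry N i j ≡ entry M i j
  N-keeps ¬r = trans (cong (λ L → entry L _ _) (sym (interchange≡N pquv))) (interchange-keeps M p q u v ¬r)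

  N-differs⇒inRectangle : ∀ {i j} → entry N i j ≢ entry M i j → InRectangle p q u v i j
  N-differs⇒inRectangle {i} {j} N≢M with inRectangle? p q u v i j
  ... | yes r = r
  ... | no ¬r = contradiction (N-keeps ¬r) N≢M

  inversion-unique : ∀ {i i' j} → Inversion M i i' j → i ≡ p × i' ≡ q × j ≡ u
  inversion-unique inv@(i<i' , ij , _) with inversion⇒interchangeable inv
  ... | _ , ι with N-differs⇒inRectangle (N-differs-inside ι (inj₁ refl , inj₁ refl))
                 | N-differs⇒inRectangle (N-differs-inside ι (inj₂ refl , inj₁ refl))
  ... | inj₁ refl , j∈ | inj₂ refl , _ = refl , refl , fromInj₁ (⊥-elim ∘ p-zero⇒≢v ij) j∈
  ... | inj₁ refl , _  | inj₁ refl , _ = ⊥-elim (<-irrefl refl i<i')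
  ... | inj₂ refl , _  | inj₁ refl , _ = ⊥-elim (<-asym i<i' p<q)
  ... | inj₂ refl , _  | inj₂ refl , _ = ⊥-elim (<-irrefl refl i<i')

  no-row-between : ∀ r → toℕ p < toℕ r → toℕ r < toℕ q → ⊥
  no-row-between r p<r r<q with entry M r u in ru
  ... | false = <-irrefl (cong toℕ (sym (proj₁ (inversion-unique (r<q , ru , qu))))) p<r
  ... | true  = <-irrefl (cong toℕ (proj₁ (proj₂ (inversion-unique (p<r , pu , ru))))) r<q

  adjacent : toℕ q ≡ suc (toℕ p)
  adjacent = ≤-antisym (≮⇒≥ gap) p<q
    where
    gap : ¬ suc (toℕ p) < toℕ q
    gap p+1<q = no-row-between r (≤-reflexive (sym r≡p+1)) (subst (_< toℕ q) (sym r≡p+1) p+1<q)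
      where
      r<s : suc (toℕ p) < s
      r<s = <-trans p+1<q (toℕ<n q)
      r : Fin s
      r = fromℕ< r<s
      r≡p+1 : toℕ r ≡ suc (toℕ p)
      r≡p+1 = toℕ-fromℕ< r<s

  columns-topJustified : ∀ {j} → j ≢ u → TopJustified (λ i → entry M i j)
  columns-topJustified j≢u i i' i<i' ij i'j = j≢u (proj₂ (proj₂ (inversion-unique (i<i' , ij , i'j))))

  rows-agree-off : ∀ j → j ≢ u → j ≢ v → entry M p j ≡ entry M q j
  rows-agree-off j j≢u j≢v with entry M p j in pj | entry M q j in qj
  ... | false | false = refl
  ... | true  | true  = refl
  ... | false | true  = ⊥-elim (j≢u (proj₂ (proj₂ (inversion-unique (p<q , pj , qj)))))
  ... | true  | false = ⊥-elim ([ j≢u , j≢v ] (proj₂ (N-differs⇒inRectangle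
                          (N-differs-inside (pu , qu , pj , qj) (inj₁ refl , inj₂ refl)))))

  α-rows-equal : part α (suc (toℕ p)) ≡ part α (suc (toℕ q))
  α-rows-equal = begin
    part α (suc (toℕ p)) ≡⟨ proj₁ M-margins p ⟨
    rowSum M p           ≡⟨ sumFin-transpose t u v (cong b2n (trans pu (sym qv))) (cong b2n (trans pv (sym qu)))
                              (λ j j≢u j≢v → cong b2n (rows-agree-off j j≢u j≢v)) ⟩
    rowSum M q           ≡⟨ proj₁ M-margins q ⟩
    part α (suc (toℕ q)) ∎
    where open ≡-Reasoning

  N-inversion : Inversion N p q v
  N-inversion = p<q , trans (N-flips (inj₁ refl , inj₂ refl)) (cong not pv)
                    , trans (N-flips (inj₂ refl , inj₂ refl)) (cong not qv)

BoxMovedUp : ℕ → List ℕ → List ℕ → Set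
BoxMovedUp s α β = ∃[ a ] (1 ≤ a × a < s × part α a ≡ part α (suc a) ×
  part β a ≡ suc (part α a) × part β (suc a) + 1 ≡ part α a ×
  (∀ (i : ℕ) → 1 ≤ i → i ≢ a → i ≢ suc a → part β i ≡ part α i))

module Shape
  {s t} {α β : List ℕ} (α↓ : Linked _≥_ α) (β↓ : Linked _≥_ β)
  (β₁≤t : part β 1 ≤ t) (α'₁≤s : conj α 1 ≤ s) (β'₁≤s : conj β 1 ≤ s)
  {M N : Matrix01 s t} (M≢N : M ≢ N) (M-margins : HasMargins α β M) (N-margins : HasMargins α β N)
  (only-M-N : ∀ L → HasMargins α β L → L ≡ M ⊎ L ≡ N)
  {p q : Fin s} {u : Fin t} (pqu : Inversion M p q u)
  where

  open UniqueInterchange {β = β} α↓ M≢N M-margins N-margins only-M-N pqu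

  -- N has the inversion (p, q, v), so the same argument applies with M and N exchanged.
  module Sym = UniqueInterchange {β = β} α↓ (M≢N ∘ sym) N-margins M-margins
    (λ L hL → swap (only-M-N L hL)) N-inversion

  N-column-u : ∀ x → entry N x u ≡ does (toℕ x <? colSum M u)
  N-column-u x = trans (topJustified⇒initial (Sym.columns-topJustified (p-zero⇒≢v pu)) x)
    (cong (λ c → does (toℕ x <? c)) (trans (proj₂ N-margins u) (sym (proj₂ M-margins u))))

  row-identity : ∀ x → part α (suc (toℕ x)) + b2n (entry N x u) ≡ part β (suc (toℕ x)) + b2n (entry M x u)
  row-identity x = begin
    part α (suc (toℕ x)) + b2n (entry N x u)
      ≡⟨ cong₂ _+_ (sym (proj₁ M-margins x)) (cong b2n (N-column-u x)) ⟩
    rowSum M x + b2n (does (toℕ x <? colSum M u))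
      ≡⟨ sumFin-exchange t u (λ j j≢u → cong b2n (topJustified⇒initial (columns-topJustified j≢u) x)) ⟩
    count {t} (λ j → does (toℕ x <? colSum M j)) + b2n (entry M x u)
      ≡⟨ cong (_+ b2n (entry M x u)) (sumFin-cong t λ j → cong (λ c → b2n (does (toℕ x <? c))) (proj₂ M-margins j)) ⟩
    count {t} (λ j → does (toℕ x <? conj β (suc (toℕ j)))) + b2n (entry M x u)
      ≡⟨ cong (_+ b2n (entry M x u)) (count-conj β↓ β₁≤t (toℕ x)) ⟩
    part β (suc (toℕ x)) + b2n (entry M x u)
      ∎
    where open ≡-Reasoning

  row-identity-at : ∀ x {b c} → entry N x u ≡ b → entry M x u ≡ c →
    part α (suc (toℕ x)) + b2n b ≡ part β (suc (toℕ x)) + b2n c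
  row-identity-at x Nxu Mxu = subst₂ (λ b c → _ + b2n b ≡ _ + b2n c) Nxu Mxu (row-identity x)

  β≡α-elsewhere : ∀ k → k ≢ toℕ p → k ≢ toℕ q → part β (suc k) ≡ part α (suc k)
  β≡α-elsewhere k k≢p k≢q with k <? s
  ... | no  k≮s = trans (part-vanishes β↓ β'₁≤s (≮⇒≥ k≮s)) (sym (part-vanishes α↓ α'₁≤s (≮⇒≥ k≮s)))
  ... | yes k<s = subst (λ k → part β (suc k) ≡ part α (suc k)) (toℕ-fromℕ< k<s)
                    (sym (+-cancelʳ-≡ _ _ _ (row-identity-at x (N-keeps x∉) refl)))
    where
    x : Fin s
    x = fromℕ< k<s
    x∉ : ¬ InRectangle p q u v x u
    x∉ (inj₁ x≡p , _) = k≢p (trans (sym (toℕ-fromℕ< k<s)) (cong toℕ x≡p))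
    x∉ (inj₂ x≡q , _) = k≢q (trans (sym (toℕ-fromℕ< k<s)) (cong toℕ x≡q))

  boxMovedUp : BoxMovedUp s α β
  boxMovedUp = suc (toℕ p) , s≤s z≤n , subst (_< s) adjacent (toℕ<n q) ,
    trans α-rows-equal (cong (λ k → part α (suc k)) adjacent) , raised ,
    subst (λ k → part β (suc k) + 1 ≡ part α (suc (toℕ p))) adjacent lowered , elsewhere
    where
    open ≡-Reasoning
    raised : part β (suc (toℕ p)) ≡ suc (part α (suc (toℕ p)))
    raised = begin
      part β (suc (toℕ p))       ≡⟨ +-identityʳ _ ⟨
      part β (suc (toℕ p)) + 0   ≡⟨ row-identity-at p (trans (N-flips (inj₁ refl , inj₁ refl)) (cong not pu)) pu ⟨
      part α (suc (toℕ p)) + 1   ≡⟨ +-comm _ 1 ⟩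
      suc (part α (suc (toℕ p))) ∎
    lowered : part β (suc (toℕ q)) + 1 ≡ part α (suc (toℕ p))
    lowered = begin
      part β (suc (toℕ q)) + 1   ≡⟨ row-identity-at q (trans (N-flips (inj₂ refl , inj₁ refl)) (cong not qu)) qu ⟨
      part α (suc (toℕ q)) + 0   ≡⟨ +-identityʳ _ ⟩
      part α (suc (toℕ q))       ≡⟨ α-rows-equal ⟨
      part α (suc (toℕ p))       ∎
    elsewhere : ∀ i → 1 ≤ i → i ≢ suc (toℕ p) → i ≢ suc (suc (toℕ p)) → part β i ≡ part α i
    elsewhere (suc k) _ i≢a i≢a+1 =
      β≡α-elsewhere k (i≢a ∘ cong suc) (λ k≡q → i≢a+1 (cong suc (trans k≡q adjacent)))

proposition3p12 : (s t : ℕ) → Coprime s t → 2 ≤ s → 2 ≤ t →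
    (α β : List ℕ) → IsPartition α → IsPartition β →
    part α 1 ≤ t → part β 1 ≤ t → conj α 1 ≤ s → conj β 1 ≤ s →
    (Σ (Matrix01 s t) λ M₁ → Σ (Matrix01 s t) λ M₂ →
      M₁ ≢ M₂ × HasMargins α β M₁ × HasMargins α β M₂ ×
      (∀ (M : Matrix01 s t) → HasMargins α β M → M ≡ M₁ ⊎ M ≡ M₂)) →
    ∃[ a ] (1 ≤ a × a < s × part α a ≡ part α (suc a) ×
      part β a ≡ suc (part α a) × part β (suc a) + 1 ≡ part α a ×
      (∀ (i : ℕ) → 1 ≤ i → i ≢ a → i ≢ suc a → part β i ≡ part α i))
proposition3p12 s t _ _ _ α β (α↓ , _) (β↓ , _) _ β₁≤t α'₁≤s β'₁≤s (M , N , M≢N , M-margins , N-margins , only-M-N)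
  with hasInversion? M | hasInversion? N
... | yes (_ , _ , _ , inv) | _ =
  Shape.boxMovedUp α↓ β↓ β₁≤t α'₁≤s β'₁≤s M≢N M-margins N-margins only-M-N inv
... | no _ | yes (_ , _ , _ , inv) =
  Shape.boxMovedUp α↓ β↓ β₁≤t α'₁≤s β'₁≤s (M≢N ∘ sym) N-margins M-margins (λ L hL → swap (only-M-N L hL)) inv
... | no ¬invM | no ¬invN =
  contradiction (inversionFree-unique ¬invM ¬invN λ j → trans (proj₂ M-margins j) (sym (proj₂ N-margins j))) M≢N
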